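{- Let $k\ge 3$ and $c,c'\in[k]$. The partially pre-coloured graph gadget $H=H(i,i',c,c')$ has the following properties: (1) $H$ has $O(k)$ vertices; (2) $H$ has two pre-coloured vertices, each of degree $O(k)$; (3) for every pair $(b,b')\in[k]^2$ with $(b,b')\neq(c,c')$ there is a legal $k$-colouring $\chi$ of $H$ extending the pre-colouring with $\chi(i)=b$ and $\chi(i')=b'$, whereas no legal $k$-colouring of $H$ extending the pre-colouring has $(\chi(i),\chi(i'))=(c,c')$.
   Context: The gadget $H(i,i',c,c')$ is built as follows. Take two vertices $i,i'$ and two disjoint $k$-cliques with vertices $\ell_1,\dots,\ell_k$ (left clique) and $r_1,\dots,r_k$ (right clique). Add the edge $\{i,\ell_1\}$; add a new vertex $w$ pre-coloured with colour $c$ and adjacent to $\ell_2,\dots,\ell_{k-1}$. Add the edge $\{i',r_1\}$; add a new vertex $w'$ pre-coloured with colour $c'$ and adjacent to $r_2,\dots,r_{k-1}$. Finally, if $c=c'$ add the edge $\{\ell_k,r_k\}$; if $c\neq c'$ instead identify $\ell_k$ and $r_k$ into a single vertex. A legal $k$-colouring is a map $\chi$ from vertices to $[k]$ giving adjacent vertices different colours; it extends the pre-colouring if $\chi(w)=c$ and $\chi(w')=c'$. -}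

module Defs where

open import Data.Nat using (ℕ; zero; suc; _+_; _∸_; _≡ᵇ_)
open import Data.Bool using (Bool; true; false; if_then_else_; _∧_; _∨_)
open import Data.Fin using (Fin; toℕ; _≟_)
open import Data.List using (List; []; _∷_; _++_; map; concatMap; upTo)
open import Data.Bool.ListAction using (any)
open import Data.Nat.ListAction using (sum)
open import Data.Product using (_×_; _,_)
open import Relation.Nullary using (does; ¬_)
open import Relation.Binary.PropositionalEquality using (_≡_)

-- Vertices are Fin (nV k c c'); we name them by their ℕ label (toℕ):
--   0 = i, 1 = i', 2 = w (pre-coloured c), 3 = w' (pre-coloured c'),
--   L j = 3 + j  (j = 1..k)   : left clique  ℓ_1..ℓ_k
--   R j = 3 + k + j (j = 1..k): right clique r_1..r_k, except that when
--   c ≠ c' the vertex r_k is identified with ℓ_k, i.e. R k = L k.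

same : {k : ℕ} → Fin k → Fin k → Bool
same c c' = does (c ≟ c')

nV : (k : ℕ) → Fin k → Fin k → ℕ
nV k c c' = if same c c' then 4 + (k + k) else 3 + (k + k)

labI labI' labW labW' : ℕ
labI = 0
labI' = 1
labW = 2
labW' = 3

labL : ℕ → ℕ
labL j = 3 + j

labR : (k : ℕ) → Fin k → Fin k → ℕ → ℕ
labR k c c' j =
  if same c c' then 3 + k + j
  else (if j ≡ᵇ k then labL k else 3 + k + j)

interval : ℕ → ℕ → List ℕ
interval lo hi = map (lo +_) (upTo (suc hi ∸ lo))

cliqueEdges : ℕ → (ℕ → ℕ) → List (ℕ × ℕ)
cliqueEdges k f =
  concatMap (λ a → map (λ b → (f a , f b)) (interval (suc a) k)) (interval 1 k)

edges : (k : ℕ) → Fin k → Fin k → List (ℕ × ℕ)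
edges k c c' =
  cliqueEdges k labL
  ++ cliqueEdges k (labR k c c')
  ++ (labI , labL 1) ∷ map (λ j → (labW , labL j)) (interval 2 (k ∸ 1))
  ++ (labI' , labR k c c' 1) ∷ map (λ j → (labW' , labR k c c' j)) (interval 2 (k ∸ 1))
  ++ (if same c c' then (labL k , labR k c c' k) ∷ [] else [])

adjℕ : (k : ℕ) → Fin k → Fin k → ℕ → ℕ → Bool
adjℕ k c c' x y =
  any (λ { (p , q) → ((p ≡ᵇ x) ∧ (q ≡ᵇ y)) ∨ ((p ≡ᵇ y) ∧ (q ≡ᵇ x)) }) (edges k c c')

Adj : (k : ℕ) (c c' : Fin k) → Fin (nV k c c') → Fin (nV k c c') → Set
Adj k c c' u v = adjℕ k c c' (toℕ u) (toℕ v) ≡ true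

degree : (k : ℕ) → Fin k → Fin k → ℕ → ℕ
degree k c c' x = sum (map (λ y → if adjℕ k c c' x y then 1 else 0) (upTo (nV k c c')))

Colouring : (k : ℕ) → Fin k → Fin k → Set
Colouring k c c' = Fin (nV k c c') → Fin k

Legal : (k : ℕ) (c c' : Fin k) → Colouring k c c' → Set
Legal k c c' χ = ∀ u v → Adj k c c' u v → ¬ (χ u ≡ χ v)

HasColour : (k : ℕ) (c c' : Fin k) → Colouring k c c' → ℕ → Fin k → Set
HasColour k c c' χ x b = ∀ u → toℕ u ≡ x → χ u ≡ b

ExtendsPre : (k : ℕ) (c c' : Fin k) → Colouring k c c' → Set
ExtendsPre k c c' χ = HasColour k c c' χ labW c × HasColour k c c' χ labW' c'

{-# OPTIONS --safe #-}
-- In a legal colouring, ℓ₁ avoids χ(i) and ℓ₂,…,ℓₖ₋₁ avoid χ(w) = c, so if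
-- χ(i) = c the k-clique ℓ₁,…,ℓₖ must use c on ℓₖ; likewise χ(i') = c' forces c' on rₖ,
-- which contradicts the edge ℓₖrₖ (c = c') or the identification ℓₖ = rₖ (c ≠ c').
-- Conversely, for (b, b') ≠ (c, c') colour each clique by a permutation of [k] with
-- prescribed colours at its two ends; choosing the end colours so that c resp. c' is one of them
-- keeps the middle vertices away from w resp. w', and the last colours can be made to agree
-- or differ as the link ℓₖrₖ demands.

module Submission where

open import Defs
open import Data.Bool using (Bool; true; false; T; if_then_else_; _∧_; _∨_)
open import Data.Bool.ListAction using (any)
open import Data.Bool.Properties using (T-≡; T-∧; T-∨)
open import Data.Empty using (⊥)
open import Data.Fin using (Fin; zero; toℕ; fromℕ<; punchIn; punchOut) renaming (_≟_ to _≟ᶠ_; _<_ to _<ᶠ_)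
open import Data.Fin.Permutation using (Permutation′; _⟨$⟩ʳ_; _∘ₚ_; transpose)
import Data.Fin.Permutation.Components as PC
open import Data.Fin.Properties
  using (toℕ-fromℕ<; toℕ≤pred[n]; pigeonhole; punchOut-injective; punchInᵢ≢i; punchIn-injective; punchIn-punchOut)
open import Data.List using (List; []; _∷_; _++_; map; upTo; length)
open import Data.List.Membership.Propositional using (_∈_)
open import Data.List.Membership.Propositional.Properties
  using (∈-map⁺; ∈-map⁻; ∈-++⁺ˡ; ∈-++⁺ʳ; ∈-concat⁺′; ∈-upTo⁺; ∈-upTo⁻)
open import Data.List.Properties using (length-upTo)
open import Data.List.Relation.Unary.All using (All; []; _∷_; lookup; lookupAny; tabulate)
open import Data.List.Relation.Unary.All.Properties using (map⁺; ++⁺; concat⁺)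
import Data.List.Relation.Unary.Any as Any
open import Data.List.Relation.Unary.Any.Properties using (any⁺; any⁻)
open import Data.Nat using (ℕ; zero; suc; _+_; _*_; _∸_; _≤_; _<_; _<?_; _%_; _≡ᵇ_; z≤n; s≤s; s≤s⁻¹; NonZero)
open import Data.Nat.DivMod using (_mod_; m<n⇒m%n≡m)
open import Data.Nat.ListAction using (sum)
open import Data.Nat.Properties
open import Data.Nat.Tactic.RingSolver using (solve-∀)
open import Data.Product using (_×_; _,_; ∃; ∃₂; Σ)
open import Data.Sum using (_⊎_; inj₁; inj₂; [_,_]′)
import Data.Sum as Sum
open import Function using (_∘_; Equivalence; Injection)
open import Function.Properties.Inverse using (↔⇒↣)
open import Relation.Binary.PropositionalEquality
  using (_≡_; _≢_; refl; sym; trans; cong; cong₂; subst; subst₂; module ≡-Reasoning)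
open import Relation.Nullary using (¬_; yes; no; proof; contradiction)
open import Relation.Nullary.Decidable using (dec-true; dec-false)
open import Relation.Nullary.Reflects using (Reflects; ofʸ; ofⁿ)

-- The gadget with the test `same c c'` abstracted to a boolean s, so that proofs can
-- split on it; for s = same c c' these unfold to nV, labR, edges and adjℕ.

nVˢ : ℕ → Bool → ℕ
nVˢ k s = if s then 4 + (k + k) else 3 + (k + k)

labRˢ : ℕ → Bool → ℕ → ℕ
labRˢ k s j = if s then 3 + k + j else (if j ≡ᵇ k then labL k else 3 + k + j)

edgesˢ : ℕ → Bool → List (ℕ × ℕ)
edgesˢ k s =
  cliqueEdges k labL
  ++ cliqueEdges k (labRˢ k s)
  ++ (labI , labL 1) ∷ map (λ j → (labW , labL j)) (interval 2 (k ∸ 1))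
  ++ (labI' , labRˢ k s 1) ∷ map (λ j → (labW' , labRˢ k s j)) (interval 2 (k ∸ 1))
  ++ (if s then (labL k , labRˢ k s k) ∷ [] else [])

joins : ℕ → ℕ → ℕ × ℕ → Bool
joins x y (p , q) = ((p ≡ᵇ x) ∧ (q ≡ᵇ y)) ∨ ((p ≡ᵇ y) ∧ (q ≡ᵇ x))

adjˢ : ℕ → Bool → ℕ → ℕ → Bool
adjˢ k s x y = any (joins x y) (edgesˢ k s)

Legalˢ : (k : ℕ) (s : Bool) → (Fin (nVˢ k s) → Fin k) → Set
Legalˢ k s χ = ∀ u v → adjˢ k s (toℕ u) (toℕ v) ≡ true → χ u ≢ χ v

Colours : ∀ {n k} → (Fin n → Fin k) → ℕ → Fin k → Set
Colours χ x b = ∀ u → toℕ u ≡ x → χ u ≡ b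

Extension : (k : ℕ) (s : Bool) (c c' b b' : Fin k) → Set
Extension k s c c' b b' = ∃ λ (χ : Fin (nVˢ k s) → Fin k) → Legalˢ k s χ
  × (Colours χ labW c × Colours χ labW' c') × Colours χ labI b × Colours χ labI' b'

Separated : ∀ {k} → (ℕ → Fin k) → ℕ × ℕ → Set
Separated G (p , q) = G p ≢ G q

joins-refl : ∀ x y → T (joins x y (x , y))
joins-refl x y = Equivalence.from T-∨ (inj₁ (Equivalence.from T-∧ (≡⇒≡ᵇ x x refl , ≡⇒≡ᵇ y y refl)))

joins⇒endpoints : ∀ x y e → T (joins x y e) → e ≡ (x , y) ⊎ e ≡ (y , x)
joins⇒endpoints x y (p , q) t = Sum.map endpoints endpoints (Equivalence.to T-∨ t)
  where
  endpoints : ∀ {u v} → T ((p ≡ᵇ u) ∧ (q ≡ᵇ v)) → (p , q) ≡ (u , v)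
  endpoints {u} {v} t′ with tp , tq ← Equivalence.to T-∧ t′ = cong₂ _,_ (≡ᵇ⇒≡ p u tp) (≡ᵇ⇒≡ q v tq)

any-joins-complete : ∀ {x y} es → (x , y) ∈ es → any (joins x y) es ≡ true
any-joins-complete {x} {y} es xy∈ =
  Equivalence.to T-≡ (any⁺ (joins x y) (Any.map (λ { refl → joins-refl x y }) xy∈))

any-joins-separated : ∀ {k} {G : ℕ → Fin k} {x y} es →
  All (Separated G) es → any (joins x y) es ≡ true → G x ≢ G y
any-joins-separated {G = G} {x} {y} es sep adj =
  separated (lookupAny sep (any⁻ (joins x y) es (Equivalence.from T-≡ adj)))
  where
  separated : ∀ {e} → Separated G e × T (joins x y e) → G x ≢ G y
  separated {e} (sepₑ , tₑ) with joins⇒endpoints x y e tₑ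
  ... | inj₁ refl = sepₑ
  ... | inj₂ refl = sepₑ ∘ sym

m<n∸o⇒o+m<n : ∀ o {m n} → m < n ∸ o → o + m < n
m<n∸o⇒o+m<n zero           m<n = m<n
m<n∸o⇒o+m<n (suc o) {n = suc n} m<n∸o = s≤s (m<n∸o⇒o+m<n o m<n∸o)

∈-interval⁺ : ∀ {lo hi m} → lo ≤ m → m ≤ hi → m ∈ interval lo hi
∈-interval⁺ {lo} {hi} {m} lo≤m m≤hi = subst (_∈ interval lo hi) (m+[n∸m]≡n lo≤m)
  (∈-map⁺ (lo +_) (∈-upTo⁺ (∸-monoˡ-< (s≤s m≤hi) lo≤m)))

∈-interval⁻ : ∀ {lo hi m} → m ∈ interval lo hi → lo ≤ m × m ≤ hi
∈-interval⁻ {lo} m∈ with i , i∈ , refl ← ∈-map⁻ (lo +_) m∈ = m≤m+n lo i , s≤s⁻¹ (m<n∸o⇒o+m<n lo (∈-upTo⁻ i∈))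

All-interval : ∀ {P : ℕ → Set} lo hi → (∀ m → lo ≤ m → m ≤ hi → P m) → All P (interval lo hi)
All-interval lo hi P-between = tabulate λ m∈ → let lo≤m , m≤hi = ∈-interval⁻ m∈ in P-between _ lo≤m m≤hi

∈-cliqueEdges : ∀ {k} (f : ℕ → ℕ) {a b} → 1 ≤ a → a < b → b ≤ k → (f a , f b) ∈ cliqueEdges k f
∈-cliqueEdges {k} f {a} 1≤a a<b b≤k = ∈-concat⁺′ (∈-map⁺ (λ b → (f a , f b)) (∈-interval⁺ a<b b≤k))
  (∈-map⁺ (λ a → map (λ b → (f a , f b)) (interval (suc a) k)) (∈-interval⁺ 1≤a (≤-trans (<⇒≤ a<b) b≤k)))

All-cliqueEdges : ∀ {k} {P : ℕ × ℕ → Set} (f : ℕ → ℕ) →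
  (∀ a b → 1 ≤ a → a < b → b ≤ k → P (f a , f b)) → All P (cliqueEdges k f)
All-cliqueEdges {k} f P-clique = concat⁺ (map⁺ (All-interval 1 k λ a 1≤a _ →
  map⁺ (All-interval (suc a) k λ b a<b b≤k → P-clique a b 1≤a a<b b≤k)))

record Edgewise (k : ℕ) (s : Bool) (P : ℕ × ℕ → Set) : Set where
  field
    left-clique  : ∀ a b → 1 ≤ a → a < b → b ≤ k → P (labL a , labL b)
    right-clique : ∀ a b → 1 ≤ a → a < b → b ≤ k → P (labRˢ k s a , labRˢ k s b)
    i-ℓ₁ : P (labI , labL 1)
    w-ℓ : ∀ j → 2 ≤ j → j ≤ k ∸ 1 → P (labW , labL j)
    i'-r₁ : P (labI' , labRˢ k s 1)
    w'-r : ∀ j → 2 ≤ j → j ≤ k ∸ 1 → P (labW' , labRˢ k s j)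
    ℓₖ-rₖ : s ≡ true → P (labL k , labRˢ k s k)

All-link : ∀ {P : ℕ × ℕ → Set} s {e} → (s ≡ true → P e) → All P (if s then e ∷ [] else [])
All-link true  Pe = Pe refl ∷ []
All-link false _  = []

∈-link : ∀ {A : Set} {s} {e : A} → s ≡ true → e ∈ (if s then e ∷ [] else [])
∈-link refl = Any.here refl

All-edgesˢ : ∀ {k s P} → Edgewise k s P → All P (edgesˢ k s)
All-edgesˢ {k} {s} E =
  ++⁺ (All-cliqueEdges labL left-clique)
  (++⁺ (All-cliqueEdges (labRˢ k s) right-clique)
  (i-ℓ₁ ∷ ++⁺ (map⁺ (All-interval 2 (k ∸ 1) w-ℓ))
  (i'-r₁ ∷ ++⁺ (map⁺ (All-interval 2 (k ∸ 1) w'-r)) (All-link s ℓₖ-rₖ))))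
  where open Edgewise E

edgewise : ∀ {k s P} → (∀ {e} → e ∈ edgesˢ k s → P e) → Edgewise k s P
edgewise {k} {s} P∈ = record
  { left-clique = λ a b 1≤a a<b b≤k → P∈ (∈-++⁺ˡ (∈-cliqueEdges labL 1≤a a<b b≤k))
  ; right-clique = λ a b 1≤a a<b b≤k → P∈ (∈-++⁺ʳ L (∈-++⁺ˡ (∈-cliqueEdges (labRˢ k s) 1≤a a<b b≤k)))
  ; i-ℓ₁ = P∈ (∈-++⁺ʳ L (∈-++⁺ʳ R (Any.here refl)))
  ; w-ℓ = λ j 2≤j j≤ → P∈ (∈-++⁺ʳ L (∈-++⁺ʳ R (Any.there (∈-++⁺ˡ (∈-map⁺ _ (∈-interval⁺ 2≤j j≤))))))
  ; i'-r₁ = P∈ (∈-++⁺ʳ L (∈-++⁺ʳ R (Any.there (∈-++⁺ʳ W (Any.here refl)))))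
  ; w'-r = λ j 2≤j j≤ → P∈ (∈-++⁺ʳ L (∈-++⁺ʳ R (Any.there (∈-++⁺ʳ W
             (Any.there (∈-++⁺ˡ (∈-map⁺ _ (∈-interval⁺ 2≤j j≤))))))))
  ; ℓₖ-rₖ = λ s≡true → P∈ (∈-++⁺ʳ L (∈-++⁺ʳ R (Any.there (∈-++⁺ʳ W (Any.there (∈-++⁺ʳ W' (∈-link s≡true)))))))
  }
  where
  L = cliqueEdges k labL
  R = cliqueEdges k (labRˢ k s)
  W = map (λ j → (labW , labL j)) (interval 2 (k ∸ 1))
  W' = map (λ j → (labW' , labRˢ k s j)) (interval 2 (k ∸ 1))

labRˢ-last : ∀ k → labRˢ k false k ≡ labL k
labRˢ-last k rewrite Equivalence.to T-≡ (≡⇒≡ᵇ k k refl) = refl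

nVˢ-lower : ∀ k s → 3 + (k + k) ≤ nVˢ k s
nVˢ-lower k true  = n≤1+n _
nVˢ-lower k false = ≤-refl

labL< : ∀ {k s j} → 1 ≤ k → j ≤ k → labL j < nVˢ k s
labL< {k} {s} k≥1 j≤k = <-≤-trans (+-monoʳ-< 3 (≤-<-trans j≤k (m<m+n k k≥1))) (nVˢ-lower k s)

labRˢ< : ∀ {k s j} → 1 ≤ k → j ≤ k → labRˢ k s j < nVˢ k s
labRˢ< {k} {true}  k≥1 j≤k = s≤s (+-monoʳ-≤ (3 + k) j≤k)
labRˢ< {k} {false} {j} k≥1 j≤k with j ≡ᵇ k in j≡ᵇk
... | true  = labL< {s = false} k≥1 ≤-refl
... | false = +-monoʳ-< (3 + k) (≤∧≢⇒< j≤k j≢k)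
  where
  j≢k : j ≢ k
  j≢k refl = subst T j≡ᵇk (≡⇒≡ᵇ j j refl)

small< : ∀ {k s x} → 1 ≤ k → x ≤ 3 → x < nVˢ k s
small< k≥1 x≤3 = ≤-<-trans x≤3 (<-trans (n<1+n 3) (labL< k≥1 k≥1))

InRange : ℕ → ℕ × ℕ → Set
InRange n (p , q) = p < n × q < n

edgewise-in-range : ∀ {k s} → 1 ≤ k → Edgewise k s (InRange (nVˢ k s))
edgewise-in-range {k} k≥1 = record
  { left-clique = λ a b _ a<b b≤k → labL< k≥1 (≤-trans (<⇒≤ a<b) b≤k) , labL< k≥1 b≤k
  ; right-clique = λ a b _ a<b b≤k → labRˢ< k≥1 (≤-trans (<⇒≤ a<b) b≤k) , labRˢ< k≥1 b≤k
  ; i-ℓ₁ = small< k≥1 z≤n , labL< k≥1 k≥1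
  ; w-ℓ = λ j _ j≤ → small< k≥1 (n≤1+n 2) , labL< k≥1 (≤-trans j≤ (m∸n≤m k 1))
  ; i'-r₁ = small< k≥1 (s≤s z≤n) , labRˢ< k≥1 k≥1
  ; w'-r = λ j _ j≤ → small< k≥1 ≤-refl , labRˢ< k≥1 (≤-trans j≤ (m∸n≤m k 1))
  ; ℓₖ-rₖ = λ _ → labL< k≥1 ≤-refl , labRˢ< k≥1 ≤-refl
  }

extend : ∀ {n k} → (Fin n → Fin k) → Fin k → ℕ → Fin k
extend {n} χ d x with x <? n
... | yes x<n = χ (fromℕ< x<n)
... | no _    = d

extend-fromℕ< : ∀ {n k} {χ : Fin n → Fin k} {d x} (x<n : x < n) → extend χ d x ≡ χ (fromℕ< x<n)
extend-fromℕ< {n} {x = x} x<n with x <? n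
... | yes _   = refl
... | no x≮n = contradiction x<n x≮n

extend-colours : ∀ {n k} {χ : Fin n → Fin k} {d x b} → x < n → Colours χ x b → extend χ d x ≡ b
extend-colours x<n χx≡b = trans (extend-fromℕ< x<n) (χx≡b _ (toℕ-fromℕ< x<n))

legal⇒separated : ∀ {k s} {χ : Fin (nVˢ k s) → Fin k} (d : Fin k) → Legalˢ k s χ →
  ∀ {x y} → x < nVˢ k s → y < nVˢ k s → adjˢ k s x y ≡ true → extend χ d x ≢ extend χ d y
legal⇒separated {k} {s} {χ} d legal {x} {y} x< y< adj χx≡χy =
  legal (fromℕ< x<) (fromℕ< y<) adj′ (trans (sym (extend-fromℕ< x<)) (trans χx≡χy (extend-fromℕ< y<)))
  where
  adj′ : adjˢ k s (toℕ (fromℕ< x<)) (toℕ (fromℕ< y<)) ≡ true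
  adj′ = subst₂ (λ u v → adjˢ k s u v ≡ true) (sym (toℕ-fromℕ< x<)) (sym (toℕ-fromℕ< y<)) adj

edgewise-of-legal : ∀ {k s} {χ : Fin (nVˢ k s) → Fin k} (d : Fin k) → 1 ≤ k → Legalˢ k s χ →
  Edgewise k s (Separated (extend χ d))
edgewise-of-legal {k} {s} d k≥1 legal = edgewise λ {e} e∈ →
  let x< , y< = lookup (All-edgesˢ (edgewise-in-range k≥1)) e∈
  in legal⇒separated d legal x< y< (any-joins-complete (edgesˢ k s) e∈)

clique-uses-every-colour : ∀ {k} (f : ℕ → Fin k) (y : Fin k) →
  (∀ a b → 1 ≤ a → a < b → b ≤ k → f a ≢ f b) → (∀ j → 1 ≤ j → j < k → f j ≢ y) → f k ≡ y
clique-uses-every-colour {suc k} f y distinct avoids with f (suc k) ≟ᶠ y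
... | yes fk≡y = fk≡y
... | no fk≢y = contradiction (pigeonhole (n<1+n k) squeeze) no-collision
  where
  avoids′ : ∀ (j : Fin (suc k)) → y ≢ f (suc (toℕ j))
  avoids′ j y≡ with m≤n⇒m<n∨m≡n (toℕ≤pred[n] j)
  ... | inj₁ j<k  = avoids (suc (toℕ j)) (s≤s z≤n) (s≤s j<k) (sym y≡)
  ... | inj₂ j≡k  = fk≢y (subst (λ m → f (suc m) ≡ y) j≡k (sym y≡))

  squeeze : Fin (suc k) → Fin k
  squeeze j = punchOut (avoids′ j)

  no-collision : ¬ (∃₂ λ i j → i <ᶠ j × squeeze i ≡ squeeze j)
  no-collision (i , j , i<j , same-image) = distinct (suc (toℕ i)) (suc (toℕ j)) (s≤s z≤n) (s≤s i<j)
    (s≤s (toℕ≤pred[n] j)) (punchOut-injective (avoids′ i) (avoids′ j) same-image)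

below-last : ∀ {k} {P : ℕ → Set} → P 1 → (∀ j → 2 ≤ j → j ≤ k ∸ 1 → P j) → ∀ j → 1 ≤ j → j < k → P j
below-last P₁ _ 1 _ _ = P₁
below-last {suc k} _ P-middle (suc (suc j)) _ j<k = P-middle (suc (suc j)) (s≤s (s≤s z≤n)) (s≤s⁻¹ j<k)

separated-from : ∀ {k} {G : ℕ → Fin k} {x y col} → G x ≡ col → Separated G (x , y) → G y ≢ col
separated-from Gx≡col sep Gy≡col = sep (trans Gx≡col (sym Gy≡col))

last-vertices-clash : ∀ {k s} {c c' : Fin k} {G : ℕ → Fin k} → Reflects (c ≡ c') s →
  Edgewise k s (Separated G) → G (labL k) ≡ c → G (labRˢ k s k) ≡ c' → ⊥
last-vertices-clash (ofʸ refl) E ℓₖ≡c rₖ≡c = Edgewise.ℓₖ-rₖ E refl (trans ℓₖ≡c (sym rₖ≡c))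
last-vertices-clash {k} {c' = c'} {G = G} (ofⁿ c≢c') E ℓₖ≡c rₖ≡c' =
  c≢c' (trans (sym ℓₖ≡c) (subst (λ v → G v ≡ c') (labRˢ-last k) rₖ≡c'))

no-extension-at : ∀ {k s} {c c' : Fin k} → 3 ≤ k → Reflects (c ≡ c') s → ¬ Extension k s c c' c c'
no-extension-at {k} {s} {c} {c'} k≥3 c≡c'? (χ , legal , (w≡c , w'≡c') , i≡c , i'≡c') =
  last-vertices-clash c≡c'? E ℓₖ≡c rₖ≡c'
  where
  k≥1 : 1 ≤ k
  k≥1 = ≤-trans (s≤s z≤n) k≥3

  G : ℕ → Fin k
  G = extend χ c

  E : Edgewise k s (Separated G)
  E = edgewise-of-legal c k≥1 legal
  open Edgewise E

  G-at : ∀ {x b} → x ≤ 3 → Colours χ x b → G x ≡ b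
  G-at x≤3 = extend-colours (small< k≥1 x≤3)

  ℓₖ≡c : G (labL k) ≡ c
  ℓₖ≡c = clique-uses-every-colour (G ∘ labL) c left-clique (below-last
    (separated-from {G = G} (G-at z≤n i≡c) i-ℓ₁)
    (λ j 2≤j j≤ → separated-from {G = G} (G-at (n≤1+n 2) w≡c) (w-ℓ j 2≤j j≤)))

  rₖ≡c' : G (labRˢ k s k) ≡ c'
  rₖ≡c' = clique-uses-every-colour (G ∘ labRˢ k s) c' right-clique (below-last
    (separated-from {G = G} (G-at (s≤s z≤n) i'≡c') i'-r₁)
    (λ j 2≤j j≤ → separated-from {G = G} (G-at ≤-refl w'≡c') (w'-r j 2≤j j≤)))

transpose-matchˡ : ∀ {n} (i j : Fin n) → PC.transpose i j i ≡ j
transpose-matchˡ i j rewrite dec-true (i ≟ᶠ i) refl = refl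

transpose-other : ∀ {n} {i j m : Fin n} → m ≢ i → m ≢ j → PC.transpose i j m ≡ m
transpose-other {i = i} {j} {m} m≢i m≢j rewrite dec-false (m ≟ᶠ i) m≢i | dec-false (m ≟ᶠ j) m≢j = refl

two-point-permutation : ∀ {n} {p q x y : Fin n} → p ≢ q → x ≢ y →
  ∃ λ (π : Permutation′ n) → π ⟨$⟩ʳ p ≡ x × π ⟨$⟩ʳ q ≡ y
two-point-permutation {p = p} {q} {x} {y} p≢q x≢y = transpose q z ∘ₚ transpose p x , π-p , π-q
  where
  -- the swap of p and x sends z to y
  z = PC.transpose x p y

  p≢z : p ≢ z
  p≢z p≡z = x≢y (begin
    x                      ≡⟨ transpose-matchˡ p x ⟨
    PC.transpose p x p     ≡⟨ cong (PC.transpose p x) p≡z ⟩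
    PC.transpose p x z     ≡⟨ PC.transpose-inverse p x ⟩
    y                      ∎)
    where open ≡-Reasoning

  π-p = trans (cong (PC.transpose p x) (transpose-other p≢q p≢z)) (transpose-matchˡ p x)
  π-q = trans (cong (PC.transpose p x) (transpose-matchˡ q z)) (PC.transpose-inverse p x)

mod-injective : ∀ {m m' n} .{{_ : NonZero n}} → m < n → m' < n → m mod n ≡ m' mod n → m ≡ m'
mod-injective {m} {m'} {n} m<n m'<n eq = begin
  m              ≡⟨ m<n⇒m%n≡m m<n ⟨
  m % n          ≡⟨ toℕ-fromℕ< _ ⟨
  toℕ (m mod n)  ≡⟨ cong toℕ eq ⟩
  toℕ (m' mod n) ≡⟨ toℕ-fromℕ< _ ⟩
  m' % n         ≡⟨ m<n⇒m%n≡m m'<n ⟩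
  m'             ∎
  where open ≡-Reasoning

avoid-two : ∀ {k} → 3 ≤ k → (a b : Fin k) → ∃ λ d → d ≢ a × d ≢ b
avoid-two (s≤s (s≤s (s≤s _))) a b with a ≟ᶠ b
... | yes refl = punchIn a zero , punchInᵢ≢i a zero , punchInᵢ≢i a zero
... | no a≢b   = punchIn a e , punchInᵢ≢i a e , d≢b
  where
  b′ = punchOut a≢b
  e = punchIn b′ zero

  d≢b : punchIn a e ≢ b
  d≢b d≡b = punchInᵢ≢i b′ zero (punchIn-injective a e b′ (trans d≡b (sym (punchIn-punchOut a≢b))))

first-colour : ∀ {k} {b cc y : Fin k} → 3 ≤ k → b ≢ cc ⊎ y ≡ cc →
  ∃ λ x → x ≢ y × x ≢ b × (cc ≡ x ⊎ cc ≡ y)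
first-colour {b = b} {cc} {y} k≥3 feasible with cc ≟ᶠ y
... | yes cc≡y = let x , x≢y , x≢b = avoid-two k≥3 y b in x , x≢y , x≢b , inj₂ cc≡y
... | no cc≢y  = cc , cc≢y , cc≢b , inj₁ refl
  where
  cc≢b : cc ≢ b
  cc≢b cc≡b = [ (λ b≢cc → b≢cc (sym cc≡b)) , (λ y≡cc → cc≢y (sym y≡cc)) ]′ feasible

-- A colouring of the clique ℓ₁,…,ℓₖ (or r₁,…,rₖ) whose first vertex is adjacent to
-- a vertex of colour b, whose middle vertices are adjacent to a vertex of colour cc,
-- and whose last vertex gets colour y.
record SideColouring (k : ℕ) (b cc y : Fin k) : Set where
  field
    colour : ℕ → Fin k
    distinct : ∀ a a' → 1 ≤ a → a < a' → a' ≤ k → colour a ≢ colour a'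
    first-avoids : b ≢ colour 1
    middle-avoid : ∀ j → 2 ≤ j → j ≤ k ∸ 1 → cc ≢ colour j
    colour-last : colour k ≡ y

first≢last-position : ∀ {k} → 1 ≤ k → 0 mod suc k ≢ k mod suc k
first≢last-position k≥1 eq = <⇒≢ k≥1 (mod-injective (s≤s z≤n) ≤-refl eq)

side-colouring : ∀ {k} {b cc y : Fin k} → 3 ≤ k → b ≢ cc ⊎ y ≡ cc → SideColouring k b cc y
side-colouring {suc k} {b} {cc} {y} k≥3@(s≤s k≥2) feasible
  with x , x≢y , x≢b , cc∈ends ← first-colour k≥3 feasible
  with π , π-first , π-last ← two-point-permutation (first≢last-position (≤-trans (s≤s z≤n) k≥2)) x≢y
  = record
  { colour = colour
  ; distinct = distinct
  ; first-avoids = λ b≡ → x≢b (sym (trans b≡ π-first))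
  ; middle-avoid = middle-avoid
  ; colour-last = π-last
  }
  where
  -- vertex j (1 ≤ j ≤ k + 1) sits at position j ∸ 1 of Fin (suc k)
  colour : ℕ → Fin (suc k)
  colour j = π ⟨$⟩ʳ ((j ∸ 1) mod suc k)

  distinct : ∀ a a' → 1 ≤ a → a < a' → a' ≤ suc k → colour a ≢ colour a'
  distinct (suc a) (suc a') _ (s≤s a<a') a'<k eq =
    <⇒≢ a<a' (mod-injective (<-trans a<a' a'<k) a'<k (Injection.injective (↔⇒↣ π) eq))

  middle-avoid : ∀ j → 2 ≤ j → j ≤ k → cc ≢ colour j
  middle-avoid j 2≤j j≤k cc≡cj = [
    (λ cc≡x → distinct 1 j ≤-refl 2≤j (m≤n⇒m≤1+n j≤k) (trans π-first (trans (sym cc≡x) cc≡cj))) ,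
    (λ cc≡y → distinct j (suc k) (<⇒≤ 2≤j) (s≤s j≤k) ≤-refl (trans (sym cc≡cj) (trans cc≡y (sym π-last)))) ]′
    cc∈ends

-- ℓₖ and rₖ are adjacent when s = true and identified when s = false.
EndsCompatible : ∀ {k} → Bool → Fin k → Fin k → Set
EndsCompatible s y y' = (s ≡ true → y ≢ y') × (s ≡ false → y ≡ y')

module _ {k : ℕ} (b b' c c' : Fin k) (left right : ℕ → Fin k) where

  labelColouring : ℕ → Fin k
  labelColouring 0 = b
  labelColouring 1 = b'
  labelColouring 2 = c
  labelColouring 3 = c'
  labelColouring (suc (suc (suc n))) with n ≤? k
  ... | yes _ = left n
  ... | no _  = right (n ∸ k)

  labelColouring-ℓ : ∀ {j} → 1 ≤ j → j ≤ k → labelColouring (labL j) ≡ left j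
  labelColouring-ℓ {suc j} _ j≤k with suc j ≤? k
  ... | yes _   = refl
  ... | no j≰k = contradiction j≤k j≰k

  labelColouring-r : ∀ {j} → 1 ≤ j → labelColouring (3 + k + j) ≡ right j
  labelColouring-r {j} 1≤j = trans (beyond-left (m<m+n k 1≤j)) (cong right (m+n∸m≡n k j))
    where
    beyond-left : ∀ {n} → k < n → labelColouring (3 + n) ≡ right (n ∸ k)
    beyond-left {suc n} k<n with suc n ≤? k
    ... | yes n<k = contradiction n<k (<⇒≱ k<n)
    ... | no _    = refl

  labelColouring-rˢ : ∀ s {j} → (s ≡ false → left k ≡ right k) → 1 ≤ j → j ≤ k →
    labelColouring (labRˢ k s j) ≡ right j
  labelColouring-rˢ true  _ 1≤j _ = labelColouring-r 1≤j
  labelColouring-rˢ false {j} shared 1≤j j≤k with j ≡ᵇ k in j≡ᵇk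
  ... | false = labelColouring-r 1≤j
  ... | true with refl ← ≡ᵇ⇒≡ j k (Equivalence.from T-≡ j≡ᵇk) =
    trans (labelColouring-ℓ 1≤j j≤k) (shared refl)

≢-via : ∀ {A : Set} {x y u v : A} → x ≡ u → y ≡ v → u ≢ v → x ≢ y
≢-via x≡u y≡v u≢v x≡y = u≢v (trans (sym x≡u) (trans x≡y y≡v))

sides-edgewise : ∀ {k s} {b b' c c' y y' : Fin k} → 1 ≤ k →
  (L : SideColouring k b c y) (R : SideColouring k b' c' y') → EndsCompatible s y y' →
  Edgewise k s (Separated (labelColouring b b' c c' (SideColouring.colour L) (SideColouring.colour R)))
sides-edgewise {k} {s} {b} {b'} {c} {c'} k≥1 L R (ends-differ , ends-agree) = record
  { left-clique = λ a a' 1≤a a<a' a'≤k →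
      ≢-via (F-ℓ 1≤a (≤-trans (<⇒≤ a<a') a'≤k)) (F-ℓ (≤-trans 1≤a (<⇒≤ a<a')) a'≤k) (L.distinct a a' 1≤a a<a' a'≤k)
  ; right-clique = λ a a' 1≤a a<a' a'≤k →
      ≢-via (F-r 1≤a (≤-trans (<⇒≤ a<a') a'≤k)) (F-r (≤-trans 1≤a (<⇒≤ a<a')) a'≤k) (R.distinct a a' 1≤a a<a' a'≤k)
  ; i-ℓ₁ = ≢-via refl (F-ℓ ≤-refl k≥1) L.first-avoids
  ; w-ℓ = λ j 2≤j j≤ → ≢-via refl (F-ℓ (<⇒≤ 2≤j) (≤-trans j≤ (m∸n≤m k 1))) (L.middle-avoid j 2≤j j≤)
  ; i'-r₁ = ≢-via refl (F-r ≤-refl k≥1) R.first-avoids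
  ; w'-r = λ j 2≤j j≤ → ≢-via refl (F-r (<⇒≤ 2≤j) (≤-trans j≤ (m∸n≤m k 1))) (R.middle-avoid j 2≤j j≤)
  ; ℓₖ-rₖ = λ s≡true → ≢-via (F-ℓ k≥1 ≤-refl) (F-r k≥1 ≤-refl)
      (≢-via L.colour-last R.colour-last (ends-differ s≡true))
  }
  where
  module L = SideColouring L
  module R = SideColouring R

  shared : s ≡ false → L.colour k ≡ R.colour k
  shared s≡false = trans L.colour-last (trans (ends-agree s≡false) (sym R.colour-last))

  F = labelColouring b b' c c' L.colour R.colour

  F-ℓ : ∀ {j} → 1 ≤ j → j ≤ k → F (labL j) ≡ L.colour j
  F-ℓ = labelColouring-ℓ b b' c c' L.colour R.colour

  F-r : ∀ {j} → 1 ≤ j → j ≤ k → F (labRˢ k s j) ≡ R.colour j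
  F-r = labelColouring-rˢ b b' c c' L.colour R.colour s shared

extension-of-sides : ∀ {k s} {b b' c c' y y' : Fin k} → 1 ≤ k →
  SideColouring k b c y → SideColouring k b' c' y' → EndsCompatible s y y' → Extension k s c c' b b'
extension-of-sides {k} {s} {b} {b'} {c} {c'} k≥1 L R compatible =
  F ∘ toℕ , legal , ((λ _ → cong F) , (λ _ → cong F)) , (λ _ → cong F) , (λ _ → cong F)
  where
  F = labelColouring b b' c c' (SideColouring.colour L) (SideColouring.colour R)

  legal : Legalˢ k s (F ∘ toℕ)
  legal u v = any-joins-separated (edgesˢ k s) (All-edgesˢ (sides-edgewise k≥1 L R compatible))

last-colours : ∀ {k s} {c c' b b' : Fin k} → 3 ≤ k → Reflects (c ≡ c') s → (b , b') ≢ (c , c') →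
  ∃ λ y → ∃ λ y' → (b ≢ c ⊎ y ≡ c) × (b' ≢ c' ⊎ y' ≡ c') × EndsCompatible s y y'
last-colours {c = c} {b = b} {b'} k≥3 (ofʸ refl) bb'≢cc with b ≟ᶠ c | avoid-two k≥3 c c
... | yes refl | d , d≢c , _ =
  c , d , inj₂ refl , inj₁ (λ b'≡c → bb'≢cc (cong (c ,_) b'≡c)) , (λ _ → d≢c ∘ sym) , λ ()
... | no b≢c   | d , d≢c , _ = d , c , inj₁ b≢c , inj₂ refl , (λ _ → d≢c) , λ ()
last-colours {c = c} {c'} {b} {b'} k≥3 (ofⁿ c≢c') bb'≢cc' with b ≟ᶠ c
... | yes refl = c , c , inj₂ refl , inj₁ (λ b'≡c' → bb'≢cc' (cong (c ,_) b'≡c')) , (λ ()) , λ _ → refl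
... | no b≢c   = c' , c' , inj₁ b≢c , inj₂ refl , (λ ()) , λ _ → refl

extension-exists : ∀ {k s} {c c' b b' : Fin k} → 3 ≤ k → Reflects (c ≡ c') s → (b , b') ≢ (c , c') →
  Extension k s c c' b b'
extension-exists k≥3 c≡c'? bb'≢cc'
  with _ , _ , left-feasible , right-feasible , compatible ← last-colours k≥3 c≡c'? bb'≢cc' =
  extension-of-sides (≤-trans (s≤s z≤n) k≥3)
    (side-colouring k≥3 left-feasible) (side-colouring k≥3 right-feasible) compatible

nVˢ≤4k : ∀ {k} s → 2 ≤ k → nVˢ k s ≤ 4 * k
nVˢ≤4k {k} s k≥2 = begin
  nVˢ k s            ≤⟨ at-most s ⟩
  4 + (k + k)        ≤⟨ +-monoˡ-≤ (k + k) (+-mono-≤ k≥2 k≥2) ⟩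
  (k + k) + (k + k)  ≡⟨ double-double k ⟩
  4 * k              ∎
  where
  open ≤-Reasoning

  at-most : ∀ s → nVˢ k s ≤ 4 + (k + k)
  at-most true  = ≤-refl
  at-most false = n≤1+n _

  double-double : ∀ n → (n + n) + (n + n) ≡ 4 * n
  double-double = solve-∀

indicator-sum≤length : ∀ {A : Set} (p : A → Bool) xs → sum (map (λ y → if p y then 1 else 0) xs) ≤ length xs
indicator-sum≤length p [] = z≤n
indicator-sum≤length p (x ∷ xs) with p x
... | true  = s≤s (indicator-sum≤length p xs)
... | false = m≤n⇒m≤1+n (indicator-sum≤length p xs)

degree≤nV : ∀ k (c c' : Fin k) x → degree k c c' x ≤ nV k c c'
degree≤nV k c c' x =
  subst (degree k c c' x ≤_) (length-upTo (nV k c c')) (indicator-sum≤length (adjℕ k c c' x) (upTo (nV k c c')))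

claim3p2 : Σ ℕ (λ C → ∀ (k : ℕ) → 3 ≤ k → (c c' : Fin k) →
    (nV k c c' ≤ C * k)
    × (degree k c c' labW ≤ C * k × degree k c c' labW' ≤ C * k)
    × ((∀ (b b' : Fin k) → ¬ ((b , b') ≡ (c , c')) →
          ∃ λ (χ : Colouring k c c') → Legal k c c' χ × ExtendsPre k c c' χ
            × HasColour k c c' χ labI b × HasColour k c c' χ labI' b')
      × ¬ (∃ λ (χ : Colouring k c c') → Legal k c c' χ × ExtendsPre k c c' χ
            × HasColour k c c' χ labI c × HasColour k c c' χ labI' c')))
claim3p2 = 4 , λ k k≥3 c c' →
  let size≤ = nVˢ≤4k (same c c') (≤-trans (n≤1+n 2) k≥3) in
  size≤ ,
  (≤-trans (degree≤nV k c c' labW) size≤ , ≤-trans (degree≤nV k c c' labW') size≤) ,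
  (λ b b' → extension-exists k≥3 (proof (c ≟ᶠ c'))) ,
  no-extension-at k≥3 (proof (c ≟ᶠ c'))
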